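{- Let $\Sigma$ be a finite totally ordered alphabet. Let $\alpha=\alpha_2^\omega\alpha_1$ and $\beta=\beta_2^\omega\beta_1$ be left-infinite strings with $\alpha_1,\beta_1\in\Sigma^*$ and $\alpha_2,\beta_2\in\Sigma^+$, and let $\alpha'$ and $\beta'$ be the suffixes of $\alpha$ and $\beta$ of length $k=|\alpha_2|+|\beta_2|+\max\{|\alpha_1|,|\beta_1|\}$. Then $\alpha'<\beta'$ if and only if $\alpha<\beta$, where $<$ is the co-lex order.
   Context: Left-infinite $\omega$-strings are built by prepending infinitely many characters; $\gamma^\omega$ denotes $\cdots\gamma\gamma\gamma$ and $\gamma^\omega\delta$ is that string followed by the finite string $\delta$. Co-lex order on $\Sigma^*\cup\Sigma^\omega$: $\epsilon<\gamma$ for every nonempty $\gamma$; for $\gamma=\gamma'a$, $\eta=\eta'b$ with $a,b\in\Sigma$, $\gamma<\eta$ iff $a<b$, or $a=b$ and $\gamma'<\eta'$. -}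

module Defs where

open import Data.Nat using (ℕ; zero; suc; _+_; _⊔_)
open import Data.Nat.DivMod using (_mod_)
open import Data.Fin using (Fin; cast) renaming (_<_ to _<ᶠ_)
open import Data.List using (List; []; _∷_; reverse; lookup; length; applyDownFrom)
open import Data.List.NonEmpty using (List⁺; _∷_) renaming (length to length⁺)
open import Data.List.Properties using (length-reverse)
open import Relation.Binary.PropositionalEquality using (_≡_; sym)

Alphabet : ℕ → Set
Alphabet σ = Fin σ

-- Left-infinite strings: position i counted from the RIGHT (i = 0 is the last char).
ωString : ℕ → Set
ωString σ = ℕ → Alphabet σ

-- Finite strings are lists in ordinary left-to-right reading order.

_^ω : ∀ {σ} → List⁺ (Alphabet σ) → ωString σ
((x ∷ xs) ^ω) i =
  lookup (reverse (x ∷ xs))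
         (cast (sym (length-reverse (x ∷ xs))) (i mod length (x ∷ xs)))

-- appending finite string (given reversed) to the right of an ω-string
appendRev : ∀ {σ} → ωString σ → List (Alphabet σ) → ωString σ
appendRev α []      i       = α i
appendRev α (a ∷ r) zero    = a
appendRev α (a ∷ r) (suc i) = appendRev α r i

_·_ : ∀ {σ} → ωString σ → List (Alphabet σ) → ωString σ
α · δ = appendRev α (reverse δ)

-- suffix of length k of a left-infinite string, as a finite string in reading order
suffix : ∀ {σ} → ωString σ → ℕ → List (Alphabet σ)
suffix α k = applyDownFrom α k

-- Co-lex order on finite strings. Lex is the recursive definition from the
-- paper applied to reversed strings (head of the list = last character).
data Lex {σ} : List (Alphabet σ) → List (Alphabet σ) → Set where
  ε<   : ∀ {b η} → Lex [] (b ∷ η)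
  hd<  : ∀ {a b γ η} → a <ᶠ b → Lex (a ∷ γ) (b ∷ η)
  tl<  : ∀ {a γ η} → Lex γ η → Lex (a ∷ γ) (a ∷ η)

_<colex_ : ∀ {σ} → List (Alphabet σ) → List (Alphabet σ) → Set
γ <colex η = Lex (reverse γ) (reverse η)

-- Co-lex order on left-infinite strings (least relation satisfying the
-- recursive definition; ε never occurs as a suffix of an ω-string).
data _<colexω_ {σ} : ωString σ → ωString σ → Set where
  hd< : ∀ {α β} → α 0 <ᶠ β 0 → α <colexω β
  tl< : ∀ {α β} → α 0 ≡ β 0 → (λ i → α (suc i)) <colexω (λ i → β (suc i)) → α <colexω β

-- Counting positions from the right, α = α₂^ω α₁ has period |α₂| from position |α₁| on,
-- and likewise β.  If two such strings agree on the last k = |α₂| + |β₂| + max(|α₁|,|β₁|)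
-- positions they agree everywhere: by strong induction, a position n = j + |α₂| + |β₂|
-- beyond that window is linked to the earlier positions j + |β₂|, j and j + |α₂| by one
-- step of either period.  Hence when α < β their first difference lies within the last
-- k characters, and there the co-lex comparisons of α, β and of their length-k suffixes
-- coincide.

module Submission where

open import Defs
open import Data.Nat using (ℕ; _+_; _⊔_)
open import Data.List using (List; length)
open import Data.List.NonEmpty using (List⁺) renaming (length to length⁺)
open import Data.Product using (_×_)

open import Data.Nat using (zero; suc; _≤_; _<_; s≤s; z<s; _<?_; NonZero; >-nonZero⁻¹)
open import Data.Nat.Properties
  using (≤-trans; <-≤-trans; ≮⇒≥; m≤m+n; m<m+n; +-identityʳ; m≤n⇒∃[o]m+o≡n; m≤m⊔n; m≤n⊔m)
open import Data.Nat.DivMod using (_mod_; [m+n]%n≡m%n)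
open import Data.Nat.Induction using (<-rec)
open import Data.Nat.Tactic.RingSolver using (solve-∀)
open import Data.Fin using (cast) renaming (_<_ to _<ᶠ_)
open import Data.Fin.Properties using (fromℕ<-cong; <-irrefl)
open import Data.List using ([]; _∷_; reverse; lookup; applyUpTo)
open import Data.List.Properties using (length-reverse; reverse-applyDownFrom)
open import Data.List.NonEmpty using (_∷_)
open import Data.Product using (∃-syntax; _,_)
open import Data.Sum using (_⊎_; inj₁; inj₂)
open import Data.Empty using (⊥-elim)
open import Function using (id; _∘_)
open import Relation.Nullary using (yes; no)
open import Relation.Binary.PropositionalEquality

private
  variable
    σ : ℕ
    α β : ωString σ

PeriodicFrom : ℕ → ℕ → ωString σ → Set
PeriodicFrom M p α = ∀ j → M ≤ j → α (j + p) ≡ α j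

PeriodicFrom-mono : ∀ {M N p} → M ≤ N → PeriodicFrom M p α → PeriodicFrom N p α
PeriodicFrom-mono M≤N per j N≤j = per j (≤-trans M≤N N≤j)

mod-+-cancelʳ : ∀ m n .{{_ : NonZero n}} → (m + n) mod n ≡ m mod n
mod-+-cancelʳ m n = fromℕ<-cong _ _ ([m+n]%n≡m%n m n) _ _

^ω-periodic : (γ : List⁺ (Alphabet σ)) → PeriodicFrom 0 (length⁺ γ) (γ ^ω)
^ω-periodic γ@(x ∷ xs) j _ =
  cong (λ i → lookup (reverse (x ∷ xs)) (cast (sym (length-reverse (x ∷ xs))) i))
       (mod-+-cancelʳ j (length⁺ γ))

appendRev-periodic : ∀ {M p} (r : List (Alphabet σ)) →
  PeriodicFrom M p α → PeriodicFrom (length r + M) p (appendRev α r)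
appendRev-periodic []      per j       M≤j       = per j M≤j
appendRev-periodic (_ ∷ r) per (suc j) (s≤s M≤j) = appendRev-periodic r per j M≤j

^ω·-periodic : (γ : List⁺ (Alphabet σ)) (δ : List (Alphabet σ)) →
  PeriodicFrom (length δ) (length⁺ γ) ((γ ^ω) · δ)
^ω·-periodic γ δ =
  subst (λ L → PeriodicFrom L (length⁺ γ) ((γ ^ω) · δ))
        (trans (+-identityʳ (length (reverse δ))) (length-reverse δ))
        (appendRev-periodic (reverse δ) (^ω-periodic γ))

AgreeBelow : ℕ → ωString σ → ωString σ → Set
AgreeBelow k α β = ∀ i → i < k → α i ≡ β i

periodicFrom-agree : ∀ {M p q} .{{_ : NonZero p}} .{{_ : NonZero q}} →
  PeriodicFrom M p α → PeriodicFrom M q β → AgreeBelow (p + q + M) α β → ∀ n → α n ≡ β n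
periodicFrom-agree {α = α} {β} {M} {p} {q} perα perβ agree = <-rec _ step
  where
  step : ∀ n → (∀ {m} → m < n → α m ≡ β m) → α n ≡ β n
  step n ih with n <? p + q + M
  ... | yes n<k = agree n n<k
  ... | no n≮k with m≤n⇒∃[o]m+o≡n (≮⇒≥ n≮k)
  ...   | o , eq = begin
      α n            ≡⟨ cong α n≡j+q+p ⟩
      α (j + q + p)  ≡⟨ perα (j + q) (≤-trans M≤j (m≤m+n j q)) ⟩
      α (j + q)      ≡⟨ ih (subst (j + q <_) (sym n≡j+q+p) (m<m+n (j + q) (>-nonZero⁻¹ p))) ⟩
      β (j + q)      ≡⟨ perβ j M≤j ⟩
      β j            ≡⟨ ih j<n ⟨
      α j            ≡⟨ perα j M≤j ⟨
      α (j + p)      ≡⟨ ih (subst (j + p <_) (sym n≡j+p+q) (m<m+n (j + p) (>-nonZero⁻¹ q))) ⟩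
      β (j + p)      ≡⟨ perβ (j + p) (≤-trans M≤j (m≤m+n j p)) ⟨
      β (j + p + q)  ≡⟨ cong β n≡j+p+q ⟨
      β n            ∎
    where
    open ≡-Reasoning
    swap-periods : ∀ p q M o → p + q + M + o ≡ M + o + q + p
    swap-periods = solve-∀
    split-periods : ∀ p q M o → p + q + M + o ≡ M + o + p + q
    split-periods = solve-∀
    j = M + o
    M≤j : M ≤ j
    M≤j = m≤m+n M o
    n≡j+q+p : n ≡ j + q + p
    n≡j+q+p = trans (sym eq) (swap-periods p q M o)
    n≡j+p+q : n ≡ j + p + q
    n≡j+p+q = trans (sym eq) (split-periods p q M o)
    j<n : j < n
    j<n = subst (j <_) (sym n≡j+p+q) (≤-trans (m<m+n j (>-nonZero⁻¹ p)) (m≤m+n (j + p) q))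

FirstDifference : ℕ → ωString σ → ωString σ → Set
FirstDifference d α β = AgreeBelow d α β × α d <ᶠ β d

<colexω⇒firstDifference : α <colexω β → ∃[ d ] FirstDifference d α β
<colexω⇒firstDifference (hd< α₀<β₀) = 0 , (λ _ ()) , α₀<β₀
<colexω⇒firstDifference (tl< α₀≡β₀ α′<β′) with <colexω⇒firstDifference α′<β′
... | d , agree , αd<βd = suc d , agree′ , αd<βd
  where
  agree′ : AgreeBelow (suc d) _ _
  agree′ zero    _         = α₀≡β₀
  agree′ (suc i) (s≤s i<d) = agree i i<d

Lex-cons : ∀ {a b : Alphabet σ} {γ η} → a ≡ b → Lex γ η → Lex (a ∷ γ) (b ∷ η)
Lex-cons refl = tl<

Lex-uncons : ∀ {a b : Alphabet σ} {γ η} → Lex (a ∷ γ) (b ∷ η) → a <ᶠ b ⊎ (a ≡ b × Lex γ η)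
Lex-uncons (hd< a<b) = inj₁ a<b
Lex-uncons (tl< γ<η) = inj₂ (refl , γ<η)

firstDifference⇒Lex-applyUpTo : ∀ {d k} → d < k → FirstDifference d α β →
  Lex (applyUpTo α k) (applyUpTo β k)
firstDifference⇒Lex-applyUpTo {d = zero}  {suc k} _         (_ , α₀<β₀) = hd< α₀<β₀
firstDifference⇒Lex-applyUpTo {d = suc d} {suc k} (s≤s d<k) (agree , αd<βd) =
  Lex-cons (agree 0 z<s)
           (firstDifference⇒Lex-applyUpTo d<k ((λ i i<d → agree (suc i) (s≤s i<d)) , αd<βd))

Lex-applyUpTo⇒<colexω : ∀ k → Lex (applyUpTo α k) (applyUpTo β k) → α <colexω β
Lex-applyUpTo⇒<colexω (suc k) prefix< with Lex-uncons prefix<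
... | inj₁ α₀<β₀           = hd< α₀<β₀
... | inj₂ (α₀≡β₀ , tail<) = tl< α₀≡β₀ (Lex-applyUpTo⇒<colexω k tail<)

<colexω⇒Lex-applyUpTo : ∀ k → (AgreeBelow k α β → ∀ n → α n ≡ β n) →
  α <colexω β → Lex (applyUpTo α k) (applyUpTo β k)
<colexω⇒Lex-applyUpTo k determined α<β with <colexω⇒firstDifference α<β
... | d , diff@(agree , αd<βd) with d <? k
...   | yes d<k = firstDifference⇒Lex-applyUpTo d<k diff
...   | no d≮k  = ⊥-elim (<-irrefl (determined agree-k d) αd<βd)
  where
  agree-k : AgreeBelow k _ _
  agree-k i i<k = agree i (<-≤-trans i<k (≮⇒≥ d≮k))

suffix-<colex≡Lex-applyUpTo : ∀ k →
  (suffix α k <colex suffix β k) ≡ Lex (applyUpTo α k) (applyUpTo β k)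
suffix-<colex≡Lex-applyUpTo {α = α} {β} k =
  cong₂ Lex (reverse-applyDownFrom α k) (reverse-applyDownFrom β k)

lemma13 : (σ : ℕ) (α₁ β₁ : List (Alphabet σ)) (α₂ β₂ : List⁺ (Alphabet σ)) →
    let α = (α₂ ^ω) · α₁
        β = (β₂ ^ω) · β₁
        k = length⁺ α₂ + length⁺ β₂ + (length α₁ ⊔ length β₁)
    in (suffix α k <colex suffix β k → α <colexω β) × (α <colexω β → suffix α k <colex suffix β k)
lemma13 σ α₁ β₁ α₂ β₂ =
    Lex-applyUpTo⇒<colexω k ∘ subst id (suffix-<colex≡Lex-applyUpTo k)
  , subst id (sym (suffix-<colex≡Lex-applyUpTo k))
      ∘ <colexω⇒Lex-applyUpTo k (periodicFrom-agree perα perβ)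
  where
  M = length α₁ ⊔ length β₁
  k = length⁺ α₂ + length⁺ β₂ + M
  perα : PeriodicFrom M (length⁺ α₂) ((α₂ ^ω) · α₁)
  perα = PeriodicFrom-mono (m≤m⊔n _ _) (^ω·-periodic α₂ α₁)
  perβ : PeriodicFrom M (length⁺ β₂) ((β₂ ^ω) · β₁)
  perβ = PeriodicFrom-mono (m≤n⊔m _ _) (^ω·-periodic β₂ β₁)
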